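{- Let $D\ge2$ be a squarefree integer and $K=\mathbb{Q}(\sqrt{D})$. The generalized quadratic form $G(z_1,z_2,z_3,z_4)=\sum_{k=1}^4\left(z_k^2-z_k\tau(z_k)+\tau(z_k)^2\right)$ is $\mathbb{Z}$-universal over $K$. In particular, there exists a $\mathbb{Z}$-universal generalized quadratic form in $4$ variables over $K$.
   Context: $\mathcal{O}_K$ is the ring of integers, $\tau: K\to K$, $a+b\sqrt{D}\mapsto a-b\sqrt{D}$. A generalized quadratic form in $n$ variables over $K$ is $G(z_1,\dots,z_n)=\sum_{i\le j}\alpha_{ij}z_iz_j+\sum_{i,j}\beta_{ij}z_i\tau(z_j)+\sum_{i\le j}\gamma_{ij}\tau(z_i)\tau(z_j)$ with coefficients in $K$, evaluated at $\mathbf{a}\in K^n$ by substituting $a_i$ for $z_i$ and $\tau(a_i)$ for $\tau(z_i)$. It is $\mathbb{Z}$-universal if it is positive definite ($G(\mathbf{a})>0$ for all nonzero $\mathbf{a}\in K^n$), integral (coefficients in $\mathcal{O}_K$), $\mathbb{Z}$-valued ($G(\mathbf{a})\in\mathbb{Z}$ for $\mathbf{a}\in\mathcal{O}_K^n$), and every positive integer equals $G(\mathbf{a})$ for some $\mathbf{a}\in\mathcal{O}_K^n$. -}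

module Defs where

open import Data.Nat as ℕ using (ℕ; zero; suc)
open import Data.Nat.Divisibility using (_∣_)
open import Data.Nat.DivMod using (_%_)
open import Data.Integer as ℤ using (ℤ; +_)
open import Data.Rational as ℚ using (ℚ; 0ℚ; 1ℚ; ½; _/_)
open import Data.Fin using (Fin; toℕ; zero; suc)
open import Data.Product using (Σ; ∃; _×_; _,_)
open import Data.Sum using (_⊎_)
open import Relation.Binary.PropositionalEquality using (_≡_; _≢_)
open import Relation.Nullary using (¬_; yes; no)

SquareFree : ℕ → Set
SquareFree D = ∀ (m : ℕ) → (m ℕ.* m) ∣ D → m ≡ 1

record K : Set where
  constructor _+_√D
  field
    re : ℚ
    im : ℚ
open K public

ℚ→K : ℚ → K
ℚ→K q = q + 0ℚ √D

ℤ→K : ℤ → K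
ℤ→K z = ℚ→K (z / 1)

0K 1K : K
0K = ℚ→K 0ℚ
1K = ℚ→K 1ℚ

_+K_ : K → K → K
(a + b √D) +K (c + d √D) = (a ℚ.+ c) + (b ℚ.+ d) √D

-K_ : K → K
-K (a + b √D) = (ℚ.- a) + (ℚ.- b) √D

mulK : ℕ → K → K → K
mulK D (a + b √D) (c + d √D) =
  (a ℚ.* c ℚ.+ ((+ D) / 1) ℚ.* b ℚ.* d) + (a ℚ.* d ℚ.+ b ℚ.* c) √D

τ : K → K
τ (a + b √D) = a + (ℚ.- b) √D

-- ring of integers O_K, via its standard integral basis:
-- O_K = ℤ[(1+√D)/2] if D ≡ 1 (mod 4), and O_K = ℤ[√D] otherwise.
InOK : ℕ → K → Set
InOK D x with D % 4
... | 1 = Σ ℤ λ m → Σ ℤ λ n → x ≡ ((m / 1) ℚ.+ (n / 1) ℚ.* ½) + ((n / 1) ℚ.* ½) √D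
... | _ = Σ ℤ λ m → Σ ℤ λ n → x ≡ (m / 1) + (n / 1) √D

-- positivity of a + b√D ∈ K ⊂ ℝ (real embedding with √D > 0)
PosK : ℕ → K → Set
PosK D (a + b √D) =
    (b ≡ 0ℚ × 0ℚ ℚ.< a)
  ⊎ (0ℚ ℚ.< b × (0ℚ ℚ.≤ a ⊎ a ℚ.* a ℚ.< ((+ D) / 1) ℚ.* b ℚ.* b))
  ⊎ (b ℚ.< 0ℚ × 0ℚ ℚ.< a × ((+ D) / 1) ℚ.* b ℚ.* b ℚ.< a ℚ.* a)

sumK : (n : ℕ) → (Fin n → K) → K
sumK zero    f = 0K
sumK (suc n) f = f zero +K sumK n (λ i → f (suc i))

sum≤ : (n : ℕ) → (Fin n → Fin n → K) → K
sum≤ n f = sumK n λ i → sumK n λ j → le i j (f i j)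
  where
  le : Fin n → Fin n → K → K
  le i j x with toℕ i ℕ.≤? toℕ j
  ... | yes _ = x
  ... | no  _ = 0K

-- A generalized quadratic form in n variables over K:
-- G(z) = Σ_{i≤j} α_ij z_i z_j + Σ_{i,j} β_ij z_i τ(z_j) + Σ_{i≤j} γ_ij τ(z_i) τ(z_j)
-- (the entries α_ij, γ_ij with i > j are ignored).
record GQF (n : ℕ) : Set where
  field
    α β γ : Fin n → Fin n → K
open GQF public

eval : (D : ℕ) {n : ℕ} → GQF n → (Fin n → K) → K
eval D {n} G a =
  (sum≤ n (λ i j → mulK D (α G i j) (mulK D (a i) (a j)))
  +K sumK n (λ i → sumK n λ j → mulK D (β G i j) (mulK D (a i) (τ (a j)))))
  +K sum≤ n (λ i j → mulK D (γ G i j) (mulK D (τ (a i)) (τ (a j))))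

PositiveDefinite : (D : ℕ) {n : ℕ} → GQF n → Set
PositiveDefinite D {n} G =
  ∀ (a : Fin n → K) → ¬ (∀ i → a i ≡ 0K) → PosK D (eval D G a)

Integral : (D : ℕ) {n : ℕ} → GQF n → Set
Integral D {n} G = ∀ (i j : Fin n) →
  (toℕ i ℕ.≤ toℕ j → InOK D (α G i j)) × InOK D (β G i j) × (toℕ i ℕ.≤ toℕ j → InOK D (γ G i j))

ℤValued : (D : ℕ) {n : ℕ} → GQF n → Set
ℤValued D {n} G =
  ∀ (a : Fin n → K) → (∀ i → InOK D (a i)) → Σ ℤ λ m → eval D G a ≡ ℤ→K m

RepresentsAllPositiveIntegers : (D : ℕ) {n : ℕ} → GQF n → Set
RepresentsAllPositiveIntegers D {n} G =
  ∀ (m : ℕ) → 1 ℕ.≤ m → Σ (Fin n → K) λ a → (∀ i → InOK D (a i)) × eval D G a ≡ ℤ→K (+ m)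

ℤUniversal : (D : ℕ) {n : ℕ} → GQF n → Set
ℤUniversal D G =
  PositiveDefinite D G × Integral D G × ℤValued D G × RepresentsAllPositiveIntegers D G

diag : {n : ℕ} → K → Fin n → Fin n → K
diag {suc _} c zero    zero    = c
diag {suc _} c zero    (suc _) = 0K
diag {suc _} c (suc _) zero    = 0K
diag {suc _} c (suc i) (suc j) = diag c i j

G₅₁₃ : GQF 4
G₅₁₃ = record { α = diag 1K ; β = diag (-K 1K) ; γ = diag 1K }

{-# OPTIONS --safe #-}
module Submission where

-- For z = x + y√D one has z² − zτ(z) + τ(z)² = (z + τ(z))² − 3zτ(z) = x² + 3Dy², so G₅₁₃ takes the
-- rational value ∑ₖ (xₖ² + 3Dyₖ²). This is positive away from 0, and it is an integer on O_K: for
-- D = 1 + 4t the half-integral points m + n(1 + √D)/2 contribute m² + mn + (1 + 3t)n². On rational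
-- integers it is a sum of four squares, so it represents every positive integer by Lagrange's
-- four-square theorem.
--
-- Euler's identity (the quaternion norm is multiplicative)
-- reduces it to primes. For an odd prime p = 2h + 1 the h + 1 residues x² and the h + 1 residues
-- −1 − y² (0 ≤ x, y ≤ h) cannot all be distinct, so mp = x² + y² + 1 with 0 < m < p. Descent: if
-- mp = ∑ xᵢ² with 1 < m, write xᵢ = yᵢ + mkᵢ with ∣2yᵢ∣ ≤ m; then ∑ yᵢ² = rm with r ≤ m, the quaternion
-- product of x and ȳ is divisible by m, and dividing out gives rp as a sum of four squares. The
-- extreme cases r = 0 and r = m would force m² ∣ mp, impossible for m < p.

open import Defs
open import Data.Nat using (ℕ; _≤_)
open import Data.Product using (_×_; Σ)

open import Algebra.Bundles.Raw using (RawRing)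
open import Data.Empty using (⊥)
open import Data.Fin using (Fin; zero; suc; toℕ; fromℕ<; #_)
open import Data.Fin.Properties using (pigeonhole; toℕ-fromℕ<; toℕ<n; ¬∀⟶∃¬)
open import Data.Integer as ℤ using (ℤ; +_; -[1+_]; 0ℤ; 1ℤ; -1ℤ; ∣_∣; _⊖_)
open import Data.Integer.DivMod using (_%ℕ_; _/ℕ_; a≡a%ℕn+[a/ℕn]*n; n%ℕd<d)
open import Data.Integer.Divisibility.Signed as ℤ∣ using (divides)
import Data.Integer.Properties as ℤP
import Data.Integer.Solver as ℤ-Solver
import Data.Integer.Tactic.RingSolver as ℤ-Ring
open import Data.List.Relation.Unary.All as All using (All)
open import Data.Nat as ℕ using (zero; suc; NonZero; _<_; z≤n; s≤s)
open import Data.Nat.DivMod using (_%_; _/_; m≡m%n+[m/n]*n)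
open import Data.Nat.Divisibility as ℕ using (_∣_; _∤_; divides; ∣⇒≤)
open import Data.Nat.Induction using (Acc; acc; <-wellFounded)
open import Data.Nat.ListAction using (product)
open import Data.Nat.Primality using (Prime; composite; prime⇒¬composite; prime⇒irreducible; euclidsLemma; ¬prime[1])
open import Data.Nat.Primality.Factorisation using (factorise; PrimeFactorisation)
import Data.Nat.Properties as ℕP
import Data.Nat.Tactic.RingSolver as ℕ-Ring
open import Data.Product using (∃; ∃-syntax; ∃₂; Σ-syntax; _,_; proj₁; proj₂; uncurry; map₂)
open import Data.Rational as ℚ using (ℚ; 0ℚ; 1ℚ; ½; toℚᵘ)
import Data.Rational.Properties as ℚP
open import Data.Rational.Solver using (module +-*-Solver)
import Data.Rational.Unnormalised as ℚᵘ
import Data.Rational.Unnormalised.Properties as ℚᵘP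
open import Data.Sum using (_⊎_; inj₁; inj₂; [_,_]′)
open import Data.Vec.Functional using (Vector; _∷_; []; map; zipWith)
open import Function using (_∘_)
open import Level using (0ℓ)
open import Relation.Binary.Definitions using (tri<; tri≈; tri>)
open import Relation.Binary.PropositionalEquality
open import Relation.Nullary using (¬_; Dec; yes; no; contradiction)
open import Relation.Nullary.Decidable using (map′; _×-dec_)
open import Algebra.Definitions.RawMonoid ℚ.+-0-rawMonoid using () renaming (sum to ∑)
open import Algebra.Definitions.RawMonoid ℤ.+-0-rawMonoid using () renaming (sum to ∑ℤ)
open import Algebra.Properties.CommutativeMonoid.Sum ℚP.+-0-commutativeMonoid using (∑-distrib-+)
open import Algebra.Properties.Monoid.Sum ℚP.+-0-monoid using (sum-cong-≗)

module Quaternions {c ℓ} (R : RawRing c ℓ) where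
  open RawRing R
  open import Algebra.Definitions.RawMonoid +-rawMonoid using (sum)

  infixl 6 _⊕_
  infixr 7 _·_
  infixl 7 _⊛_

  private
    infixl 6 _-_
    _-_ : Carrier → Carrier → Carrier
    a - b = a + - b

  _⋅_ : ∀ {n} → Vector Carrier n → Vector Carrier n → Carrier
  x ⋅ y = sum (zipWith _*_ x y)

  ∥_∥² : ∀ {n} → Vector Carrier n → Carrier
  ∥ x ∥² = x ⋅ x

  _⊕_ : ∀ {n} → Vector Carrier n → Vector Carrier n → Vector Carrier n
  _⊕_ = zipWith _+_

  _·_ : ∀ {n} → Carrier → Vector Carrier n → Vector Carrier n
  c · x = map (c *_) x

  ⟨_⟩ : Carrier → Vector Carrier 4
  ⟨ a ⟩ = a ∷ 0# ∷ 0# ∷ 0# ∷ []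

  -- the coordinates of the quaternion product x ȳ
  _⊛_ : Vector Carrier 4 → Vector Carrier 4 → Vector Carrier 4
  x ⊛ y = a₀ * b₀ + a₁ * b₁ + a₂ * b₂ + a₃ * b₃
        ∷ a₀ * b₁ - a₁ * b₀ + a₂ * b₃ - a₃ * b₂
        ∷ a₀ * b₂ - a₁ * b₃ - a₂ * b₀ + a₃ * b₁
        ∷ a₀ * b₃ + a₁ * b₂ - a₂ * b₁ - a₃ * b₀
        ∷ []
    where
    a₀ a₁ a₂ a₃ b₀ b₁ b₂ b₃ : Carrier
    a₀ = x (# 0)
    a₁ = x (# 1)
    a₂ = x (# 2)
    a₃ = x (# 3)
    b₀ = y (# 0)
    b₁ = y (# 1)
    b₂ = y (# 2)
    b₃ = y (# 3)

module FourSquares where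
  open import Data.Integer using (_+_; _*_; -_; _-_)
  open Quaternions ℤ.+-*-rawRing public
  open import Algebra.Definitions.RawMonoid ℕ.+-0-rawMonoid using () renaming (sum to ∑ℕ)

  -- Ring identities between quaternion expressions are proved by the ring solver, applied to
  -- the same expressions built over the solver's syntax.
  private
    open ℤ-Solver.+-*-Solver using (solve; _:=_; _:+_; _:*_; :-_; con; Polynomial)

    syntaxRing : ℕ → RawRing 0ℓ 0ℓ
    syntaxRing n = record
      { Carrier = Polynomial n ; _≈_ = _≡_ ; _+_ = _:+_ ; _*_ = _:*_ ; -_ = :-_
      ; 0# = con 0ℤ ; 1# = con 1ℤ }

    module S {n} = Quaternions (syntaxRing n)

    quadruple : ∀ {A : Set} → A → A → A → A → Vector A 4
    quadruple a b c d = a ∷ b ∷ c ∷ d ∷ []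

  euler-four-square : ∀ x y → ∥ x ⊛ y ∥² ≡ ∥ x ∥² * ∥ y ∥²
  euler-four-square x y = solve 8
    (λ a₀ a₁ a₂ a₃ b₀ b₁ b₂ b₃ →
      S.∥ (quadruple a₀ a₁ a₂ a₃) S.⊛ (quadruple b₀ b₁ b₂ b₃) ∥²
        := S.∥ (quadruple a₀ a₁ a₂ a₃) ∥² :* S.∥ (quadruple b₀ b₁ b₂ b₃) ∥²)
    refl (x (# 0)) (x (# 1)) (x (# 2)) (x (# 3))
         (y (# 0)) (y (# 1)) (y (# 2)) (y (# 3))

  ∥y⊕m·k∥² : ∀ m (y k : Vector ℤ 4) → ∥ y ⊕ m · k ∥² ≡ ∥ y ∥² + m * (k ⋅ (y ⊕ y) + m * ∥ k ∥²)
  ∥y⊕m·k∥² m y k = solve 9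
    (λ m y₀ y₁ y₂ y₃ k₀ k₁ k₂ k₃ →
      S.∥ (quadruple y₀ y₁ y₂ y₃) S.⊕ m S.· (quadruple k₀ k₁ k₂ k₃) ∥²
        := S.∥ (quadruple y₀ y₁ y₂ y₃) ∥²
           :+ m :* ((quadruple k₀ k₁ k₂ k₃) S.⋅ ((quadruple y₀ y₁ y₂ y₃) S.⊕ (quadruple y₀ y₁ y₂ y₃))
                    :+ m :* S.∥ (quadruple k₀ k₁ k₂ k₃) ∥²))
    refl m (y (# 0)) (y (# 1)) (y (# 2)) (y (# 3))
           (k (# 0)) (k (# 1)) (k (# 2)) (k (# 3))

  ∥[y⊕m·k]⊛y∥² : ∀ m y k → ∥ (y ⊕ m · k) ⊛ y ∥² ≡ ∥ ⟨ ∥ y ∥² ⟩ ⊕ m · (k ⊛ y) ∥²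
  ∥[y⊕m·k]⊛y∥² m y k = solve 9
    (λ m y₀ y₁ y₂ y₃ k₀ k₁ k₂ k₃ →
      S.∥ ((quadruple y₀ y₁ y₂ y₃) S.⊕ m S.· (quadruple k₀ k₁ k₂ k₃)) S.⊛ (quadruple y₀ y₁ y₂ y₃) ∥²
        := S.∥ S.⟨ S.∥ (quadruple y₀ y₁ y₂ y₃) ∥² ⟩ S.⊕ m S.· ((quadruple k₀ k₁ k₂ k₃) S.⊛ (quadruple y₀ y₁ y₂ y₃)) ∥²)
    refl m (y (# 0)) (y (# 1)) (y (# 2)) (y (# 3))
           (k (# 0)) (k (# 1)) (k (# 2)) (k (# 3))

  ∥⟨r*m⟩⊕m·w∥² : ∀ r m w → ∥ ⟨ r * m ⟩ ⊕ m · w ∥² ≡ m * (m * ∥ ⟨ r ⟩ ⊕ w ∥²)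
  ∥⟨r*m⟩⊕m·w∥² r m w = solve 6
    (λ r m w₀ w₁ w₂ w₃ →
      S.∥ S.⟨ r :* m ⟩ S.⊕ m S.· (quadruple w₀ w₁ w₂ w₃) ∥²
        := m :* (m :* S.∥ S.⟨ r ⟩ S.⊕ (quadruple w₀ w₁ w₂ w₃) ∥²))
    refl r m (w (# 0)) (w (# 1)) (w (# 2)) (w (# 3))

  ∥y⊕y∥² : ∀ (y : Vector ℤ 4) → ∥ y ⊕ y ∥² ≡ + 4 * ∥ y ∥²
  ∥y⊕y∥² y = solve 4
    (λ y₀ y₁ y₂ y₃ →
      S.∥ (quadruple y₀ y₁ y₂ y₃) S.⊕ (quadruple y₀ y₁ y₂ y₃) ∥² := con (+ 4) :* S.∥ (quadruple y₀ y₁ y₂ y₃) ∥²)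
    refl (y (# 0)) (y (# 1)) (y (# 2)) (y (# 3))

  ∑ℕ-≤ : ∀ {n c} (f : Vector ℕ n) → (∀ i → f i ≤ c) → ∑ℕ f ≤ n ℕ.* c
  ∑ℕ-≤ {zero}  f f≤c = z≤n
  ∑ℕ-≤ {suc n} f f≤c = ℕP.+-mono-≤ (f≤c zero) (∑ℕ-≤ (f ∘ suc) (f≤c ∘ suc))

  ∑ℕ≡n*c⇒≡c : ∀ {n c} (f : Vector ℕ n) → (∀ i → f i ≤ c) → ∑ℕ f ≡ n ℕ.* c → ∀ i → f i ≡ c
  ∑ℕ≡n*c⇒≡c {suc n} {c} f f≤c ∑ℕ≡ i = go i
    where
    rest≤ : ∑ℕ (f ∘ suc) ≤ n ℕ.* c
    rest≤ = ∑ℕ-≤ (f ∘ suc) (f≤c ∘ suc)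
    head≡ : f zero ≡ c
    head≡ = ℕP.≤-antisym (f≤c zero) (ℕP.≮⇒≥ λ f₀<c →
      ℕP.<-irrefl ∑ℕ≡ (ℕP.+-mono-<-≤ f₀<c rest≤))
    go : ∀ i → f i ≡ c
    go zero    = head≡
    go (suc i) = ∑ℕ≡n*c⇒≡c (f ∘ suc) (f≤c ∘ suc)
      (ℕP.+-cancelˡ-≡ c _ _ (trans (cong (ℕ._+ ∑ℕ (f ∘ suc)) (sym head≡)) ∑ℕ≡)) i

  ∑ℕ≡0⇒≡0 : ∀ {n} (f : Vector ℕ n) → ∑ℕ f ≡ 0 → ∀ i → f i ≡ 0
  ∑ℕ≡0⇒≡0 f ∑ℕ≡0 zero    = ℕP.m+n≡0⇒m≡0 (f zero) ∑ℕ≡0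
  ∑ℕ≡0⇒≡0 f ∑ℕ≡0 (suc i) = ∑ℕ≡0⇒≡0 (f ∘ suc) (ℕP.m+n≡0⇒n≡0 (f zero) ∑ℕ≡0) i

  square-injective : ∀ {a b} → a ≤ b → a ℕ.* a ≡ b ℕ.* b → a ≡ b
  square-injective a≤b a²≡b² =
    ℕP.≤-antisym a≤b (ℕP.≮⇒≥ λ a<b → ℕP.<-irrefl a²≡b² (ℕP.*-mono-< a<b a<b))

  i*i≡+∣i∣² : ∀ i → i * i ≡ + (∣ i ∣ ℕ.* ∣ i ∣)
  i*i≡+∣i∣² (+ n)    = sym (ℤP.pos-* n n)
  i*i≡+∣i∣² -[1+ n ] = refl

  ∥x∥²≡+∑ℕ∣x∣² : ∀ {n} (x : Vector ℤ n) → ∥ x ∥² ≡ + ∑ℕ (λ i → ∣ x i ∣ ℕ.* ∣ x i ∣)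
  ∥x∥²≡+∑ℕ∣x∣² {zero}  x = refl
  ∥x∥²≡+∑ℕ∣x∣² {suc n} x = trans
    (cong₂ _+_ (i*i≡+∣i∣² (x zero)) (∥x∥²≡+∑ℕ∣x∣² (x ∘ suc)))
    (sym (ℤP.pos-+ (∣ x zero ∣ ℕ.* ∣ x zero ∣) _))

  ∥∥²-cong : ∀ {n} {x y : Vector ℤ n} → (∀ i → x i ≡ y i) → ∥ x ∥² ≡ ∥ y ∥²
  ∥∥²-cong {zero}  x≗y = refl
  ∥∥²-cong {suc n} x≗y = cong₂ _+_ (cong (λ a → a * a) (x≗y zero)) (∥∥²-cong (x≗y ∘ suc))

  ∣y⇒∣x⋅y : ∀ {n d} (x y : Vector ℤ n) → (∀ i → d ℤ∣.∣ y i) → d ℤ∣.∣ x ⋅ y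
  ∣y⇒∣x⋅y {zero}  x y d∣y = divides 0ℤ refl
  ∣y⇒∣x⋅y {suc n} x y d∣y = ℤ∣.∣m∣n⇒∣m+n (ℤ∣.∣n⇒∣m*n (x zero) (d∣y zero)) (∣y⇒∣x⋅y (x ∘ suc) (y ∘ suc) (d∣y ∘ suc))

  SumOfFourSquares : ℕ → Set
  SumOfFourSquares n = Σ[ x ∈ Vector ℤ 4 ] ∥ x ∥² ≡ + n

  sumOfFourSquares-* : ∀ {m n} → SumOfFourSquares m → SumOfFourSquares n → SumOfFourSquares (m ℕ.* n)
  sumOfFourSquares-* {m} {n} (x , ∥x∥²≡m) (y , ∥y∥²≡n) = x ⊛ y , (begin
    ∥ x ⊛ y ∥²        ≡⟨ euler-four-square x y ⟩
    ∥ x ∥² * ∥ y ∥²   ≡⟨ cong₂ _*_ ∥x∥²≡m ∥y∥²≡n ⟩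
    + m * + n         ≡⟨ ℤP.pos-* m n ⟨
    + (m ℕ.* n)       ∎)
    where open ≡-Reasoning

  record CentredRemainder (m : ℕ) (x : ℤ) : Set where
    field
      remainder quotient : ℤ
      decomposition      : x ≡ remainder + + m * quotient
      small              : ∣ remainder + remainder ∣ ≤ m

  centredRemainder : ∀ m .{{_ : NonZero m}} x → CentredRemainder m x
  centredRemainder m x with x %ℕ m ℕ.+ x %ℕ m ℕ.≤? m
  ... | yes small = record
    { remainder = + r ; quotient = q ; decomposition = x≡ ; small = small }
    where
    r : ℕ
    r = x %ℕ m
    q : ℤ
    q = x /ℕ m
    x≡ : x ≡ + r + + m * q
    x≡ = trans (a≡a%ℕn+[a/ℕn]*n x m) (cong (_+_ (+ r)) (ℤP.*-comm q (+ m)))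
  ... | no large = record
    { remainder = + r - + m ; quotient = q + 1ℤ ; decomposition = x≡ ; small = small }
    where
    r : ℕ
    r = x %ℕ m
    q : ℤ
    q = x /ℕ m
    shift : ∀ r q m → r + q * m ≡ (r - m) + m * (q + 1ℤ)
    shift = ℤ-Ring.solve-∀
    x≡ : x ≡ (+ r - + m) + + m * (q + 1ℤ)
    x≡ = trans (a≡a%ℕn+[a/ℕn]*n x m) (shift (+ r) q (+ m))
    r<m : r < m
    r<m = n%ℕd<d x m
    double : (+ r - + m) + (+ r - + m) ≡ (r ℕ.+ r) ⊖ (m ℕ.+ m)
    double = trans (ring (+ r) (+ m)) (ℤP.m-n≡m⊖n (r ℕ.+ r) (m ℕ.+ m))
      where
      ring : ∀ r m → (r - m) + (r - m) ≡ (r + r) - (m + m)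
      ring = ℤ-Ring.solve-∀
    small : ∣ (+ r - + m) + (+ r - + m) ∣ ≤ m
    small = begin
      ∣ (+ r - + m) + (+ r - + m) ∣  ≡⟨ cong ∣_∣ double ⟩
      ∣ (r ℕ.+ r) ⊖ (m ℕ.+ m) ∣      ≡⟨ ℤP.∣⊖∣-≤ (ℕP.+-mono-≤ (ℕP.<⇒≤ r<m) (ℕP.<⇒≤ r<m)) ⟩
      (m ℕ.+ m) ℕ.∸ (r ℕ.+ r)        ≤⟨ ℕP.m≤n+o⇒m∸n≤o (m ℕ.+ m) (r ℕ.+ r) (ℕP.+-monoˡ-≤ m (ℕP.<⇒≤ (ℕP.≰⇒> large))) ⟩
      m                              ∎
      where open ℕP.≤-Reasoning

  norm-of-remainders-divisible : ∀ {m n} (y k : Vector ℤ 4) → ∥ y ⊕ + m · k ∥² ≡ + m * + n →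
                                 ∃[ r ] ∥ y ∥² ≡ + r * + m
  norm-of-remainders-divisible {m} {n} y k ∥x∥²≡mn =
    quotient , trans (∥x∥²≡+∑ℕ∣x∣² y) (trans (cong +_ equality) (ℤP.pos-* quotient m))
    where
    m∣∥y∥² : + m ℤ∣.∣ ∥ y ∥²
    m∣∥y∥² = ℤ∣.∣m+n∣n⇒∣m
      (subst (+ m ℤ∣.∣_) (trans (sym ∥x∥²≡mn) (∥y⊕m·k∥² (+ m) y k)) (ℤ∣.∣m⇒∣m*n (+ n) ℤ∣.∣-refl))
      (ℤ∣.∣m⇒∣m*n _ ℤ∣.∣-refl)
    open ℕ._∣_ (subst (m ∣_) (cong ∣_∣ (∥x∥²≡+∑ℕ∣x∣² y)) (ℤ∣.∣⇒∣ᵤ m∣∥y∥²))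

  euler-descent : ∀ {m n r} .{{_ : NonZero m}} (y k : Vector ℤ 4) →
                  ∥ y ⊕ + m · k ∥² ≡ + m * + n → ∥ y ∥² ≡ + r * + m → SumOfFourSquares (r ℕ.* n)
  euler-descent {m} {n} {r} y k ∥x∥²≡mn ∥y∥²≡rm =
    w , ℤP.*-cancelˡ-≡ (+ m) _ _ (ℤP.*-cancelˡ-≡ (+ m) _ _ (begin
      + m * (+ m * ∥ w ∥²)                ≡⟨ ∥⟨r*m⟩⊕m·w∥² (+ r) (+ m) (k ⊛ y) ⟨
      ∥ ⟨ + r * + m ⟩ ⊕ + m · (k ⊛ y) ∥²   ≡⟨ cong (λ a → ∥ ⟨ a ⟩ ⊕ + m · (k ⊛ y) ∥²) ∥y∥²≡rm ⟨
      ∥ ⟨ ∥ y ∥² ⟩ ⊕ + m · (k ⊛ y) ∥²      ≡⟨ ∥[y⊕m·k]⊛y∥² (+ m) y k ⟨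
      ∥ (y ⊕ + m · k) ⊛ y ∥²              ≡⟨ euler-four-square (y ⊕ + m · k) y ⟩
      ∥ y ⊕ + m · k ∥² * ∥ y ∥²            ≡⟨ cong₂ _*_ ∥x∥²≡mn ∥y∥²≡rm ⟩
      + m * + n * (+ r * + m)             ≡⟨ rearrange (+ m) (+ n) (+ r) ⟩
      + m * (+ m * (+ r * + n))           ≡⟨ cong (λ a → + m * (+ m * a)) (ℤP.pos-* r n) ⟨
      + m * (+ m * + (r ℕ.* n))           ∎))
    where
    open ≡-Reasoning
    w : Vector ℤ 4
    w = ⟨ + r ⟩ ⊕ k ⊛ y
    rearrange : ∀ m n r → m * n * (r * m) ≡ m * (m * (r * n))
    rearrange = ℤ-Ring.solve-∀

  degenerate-remainders⇒∣ : ∀ {m n} .{{_ : NonZero m}} (y k : Vector ℤ 4) →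
                            ∥ y ⊕ + m · k ∥² ≡ + m * + n → (∀ i → + m ℤ∣.∣ y i + y i) →
                            + m * + m ℤ∣.∣ ∥ y ∥² → m ∣ n
  degenerate-remainders⇒∣ {m} {n} y k ∥x∥²≡mn m∣2y m²∣∥y∥² = ℤ∣.∣⇒∣ᵤ (ℤ∣.*-cancelˡ-∣ (+ m) m²∣mn)
    where
    m∣rest : + m ℤ∣.∣ k ⋅ (y ⊕ y) + + m * ∥ k ∥²
    m∣rest = ℤ∣.∣m∣n⇒∣m+n (∣y⇒∣x⋅y k (y ⊕ y) m∣2y) (ℤ∣.∣m⇒∣m*n _ ℤ∣.∣-refl)
    m²∣mn : + m * + m ℤ∣.∣ + m * + n
    m²∣mn = subst (_ ℤ∣.∣_) (trans (sym (∥y⊕m·k∥² (+ m) y k)) ∥x∥²≡mn)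
      (ℤ∣.∣m∣n⇒∣m+n m²∣∥y∥² (ℤ∣.*-monoʳ-∣ (+ m) m∣rest))

  -- used with tᵢ = ∣2yᵢ∣ for centred remainders yᵢ with ∑ yᵢ² = rm
  doubled-remainders : ∀ {m r} .{{_ : NonZero m}} (t : Vector ℕ 4) → (∀ i → t i ≤ m) →
                       ∑ℕ (λ i → t i ℕ.* t i) ≡ 4 ℕ.* (r ℕ.* m) →
                       r ≤ m × (r ≡ 0 ⊎ r ≡ m → ∀ i → m ∣ t i)
  doubled-remainders {m} {r} t t≤m ∑ℕ≡4rm = r≤m , degenerate
    where
    t²≤m² : ∀ i → t i ℕ.* t i ≤ m ℕ.* m
    t²≤m² i = ℕP.*-mono-≤ (t≤m i) (t≤m i)
    r≤m : r ≤ m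
    r≤m = ℕP.*-cancelʳ-≤ r m m (ℕP.*-cancelˡ-≤ 4 (subst (_≤ 4 ℕ.* (m ℕ.* m)) ∑ℕ≡4rm (∑ℕ-≤ (λ i → t i ℕ.* t i) t²≤m²)))
    degenerate : r ≡ 0 ⊎ r ≡ m → ∀ i → m ∣ t i
    degenerate (inj₁ refl) i = subst (m ∣_) (square-injective z≤n (sym (∑ℕ≡0⇒≡0 (λ i → t i ℕ.* t i) ∑ℕ≡4rm i))) (m ℕ.∣0)
    degenerate (inj₂ refl) i = subst (m ∣_) (sym (square-injective (t≤m i) (∑ℕ≡n*c⇒≡c (λ i → t i ℕ.* t i) t²≤m² ∑ℕ≡4rm i))) ℕ.∣-refl

  ∑ℕ∣y⊕y∣²≡4rm : ∀ {r m} (y : Vector ℤ 4) → ∥ y ∥² ≡ + r * + m →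
                ∑ℕ (λ i → ∣ y i + y i ∣ ℕ.* ∣ y i + y i ∣) ≡ 4 ℕ.* (r ℕ.* m)
  ∑ℕ∣y⊕y∣²≡4rm {r} {m} y ∥y∥²≡rm = ℤP.+-injective (begin
    + ∑ℕ (λ i → ∣ y i + y i ∣ ℕ.* ∣ y i + y i ∣) ≡⟨ ∥x∥²≡+∑ℕ∣x∣² (y ⊕ y) ⟨
    ∥ y ⊕ y ∥²                                ≡⟨ ∥y⊕y∥² y ⟩
    + 4 * ∥ y ∥²                              ≡⟨ cong (+ 4 *_) ∥y∥²≡rm ⟩
    + 4 * (+ r * + m)                         ≡⟨ cong (+ 4 *_) (ℤP.pos-* r m) ⟨
    + 4 * + (r ℕ.* m)                         ≡⟨ ℤP.pos-* 4 (r ℕ.* m) ⟨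
    + (4 ℕ.* (r ℕ.* m))                       ∎)
    where open ≡-Reasoning

  remainder-descent : ∀ {m n r} .{{_ : NonZero m}} (y k : Vector ℤ 4) →
                      ∥ y ⊕ + m · k ∥² ≡ + m * + n → ∥ y ∥² ≡ + r * + m → (∀ i → ∣ y i + y i ∣ ≤ m) →
                      m ∤ n → ∃[ r ] 0 < r × r < m × SumOfFourSquares (r ℕ.* n)
  remainder-descent {m} {n} {r} y k ∥x∥²≡mn ∥y∥²≡rm small m∤n =
    r , ℕP.n≢0⇒n>0 {r} (degenerate⇒⊥ ∘ inj₁) , ℕP.≤∧≢⇒< r≤m (degenerate⇒⊥ ∘ inj₂) ,
    euler-descent {r = r} y k ∥x∥²≡mn ∥y∥²≡rm
    where
    analysis : r ≤ m × (r ≡ 0 ⊎ r ≡ m → ∀ i → m ∣ ∣ y i + y i ∣)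
    analysis = doubled-remainders (λ i → ∣ y i + y i ∣) small (∑ℕ∣y⊕y∣²≡4rm {r} {m} y ∥y∥²≡rm)
    r≤m : r ≤ m
    r≤m = proj₁ analysis
    m²∣∥y∥² : r ≡ 0 ⊎ r ≡ m → + m * + m ℤ∣.∣ ∥ y ∥²
    m²∣∥y∥² (inj₁ refl) = subst (_ ℤ∣.∣_) (sym ∥y∥²≡rm) (divides 0ℤ refl)
    m²∣∥y∥² (inj₂ refl) = ℤ∣.∣-reflexive (sym ∥y∥²≡rm)
    degenerate⇒⊥ : r ≡ 0 ⊎ r ≡ m → ⊥
    degenerate⇒⊥ r∈0m = m∤n (degenerate-remainders⇒∣ y k ∥x∥²≡mn
      (λ i → ℤ∣.∣ᵤ⇒∣ (proj₂ analysis r∈0m i)) (m²∣∥y∥² r∈0m))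

  descent-step : ∀ {m n} .{{_ : NonZero m}} → SumOfFourSquares (m ℕ.* n) → m ∤ n →
                 ∃[ r ] 0 < r × r < m × SumOfFourSquares (r ℕ.* n)
  descent-step {m} {n} (x , ∥x∥²≡mn) =
    remainder-descent {r = proj₁ ∥y∥²≡rm} y k ∥y⊕m·k∥²≡mn (proj₂ ∥y∥²≡rm) (CentredRemainder.small ∘ c)
    where
    c : ∀ i → CentredRemainder m (x i)
    c i = centredRemainder m (x i)
    y k : Vector ℤ 4
    y = CentredRemainder.remainder ∘ c
    k = CentredRemainder.quotient ∘ c
    ∥y⊕m·k∥²≡mn : ∥ y ⊕ + m · k ∥² ≡ + m * + n
    ∥y⊕m·k∥²≡mn = trans (∥∥²-cong (sym ∘ CentredRemainder.decomposition ∘ c)) (trans ∥x∥²≡mn (ℤP.pos-* m n))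
    ∥y∥²≡rm : ∃[ r ] ∥ y ∥² ≡ + r * + m
    ∥y∥²≡rm = norm-of-remainders-divisible y k ∥y⊕m·k∥²≡mn

  prime-descent : ∀ {p} → Prime p → ∀ m .{{_ : NonZero m}} → m < p →
                  SumOfFourSquares (m ℕ.* p) → SumOfFourSquares p
  prime-descent {p} p-prime m = go m (<-wellFounded m)
    where
    go : ∀ m .{{_ : NonZero m}} → Acc _<_ m → m < p → SumOfFourSquares (m ℕ.* p) → SumOfFourSquares p
    go 1 _ _ sum = subst SumOfFourSquares (ℕP.*-identityˡ p) sum
    go m@(suc (suc _)) (acc smaller) m<p sum = continue (descent-step sum m∤p)
      where
      m∤p : m ∤ p
      m∤p = prime⇒¬composite p-prime ∘ composite m<p
      continue : ∃[ r ] 0 < r × r < m × SumOfFourSquares (r ℕ.* p) → SumOfFourSquares p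
      continue (r , 0<r , r<m , sum′) = go r {{ℕ.>-nonZero 0<r}} (smaller r<m) (ℕP.<-trans r<m m<p) sum′

  module OddPrime (h : ℕ) (p-prime : Prime (suc (h ℕ.+ h))) where

    p : ℕ
    p = suc (h ℕ.+ h)

    h<p : h < p
    h<p = s≤s (ℕP.m≤m+n h h)

    not-divisible-if-small : ∀ {a} → 0 < a → a < p → p ∤ a
    not-divisible-if-small 0<a a<p p∣a = ℕP.<⇒≱ a<p (∣⇒≤ {{ℕ.>-nonZero 0<a}} p∣a)

    ∣u²-v²∣ : ∀ {u v} → u ≤ v → ∣ + u * + u - + v * + v ∣ ≡ (v ℕ.∸ u) ℕ.* (u ℕ.+ v)
    ∣u²-v²∣ {u} {v} u≤v = begin
      ∣ + u * + u - + v * + v ∣        ≡⟨ cong ∣_∣ (difference-of-squares (+ u) (+ v)) ⟩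
      ∣ (+ u - + v) * (+ u + + v) ∣    ≡⟨ ℤP.abs-* (+ u - + v) (+ u + + v) ⟩
      ∣ + u - + v ∣ ℕ.* (u ℕ.+ v)      ≡⟨ cong (λ a → ∣ a ∣ ℕ.* (u ℕ.+ v)) (ℤP.m-n≡m⊖n u v) ⟩
      ∣ u ⊖ v ∣ ℕ.* (u ℕ.+ v)          ≡⟨ cong (ℕ._* (u ℕ.+ v)) (ℤP.∣⊖∣-≤ u≤v) ⟩
      (v ℕ.∸ u) ℕ.* (u ℕ.+ v)          ∎
      where
      open ≡-Reasoning
      difference-of-squares : ∀ u v → u * u - v * v ≡ (u - v) * (u + v)
      difference-of-squares = ℤ-Ring.solve-∀

    squares-incongruent : ∀ {u v} → u < v → v ≤ h → ¬ (+ p ℤ∣.∣ + u * + u - + v * + v)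
    squares-incongruent {u} {v} u<v v≤h p∣u²-v² =
      [ not-divisible-if-small 0<v-u v-u<p , not-divisible-if-small 0<u+v u+v<p ]′
        (euclidsLemma (v ℕ.∸ u) (u ℕ.+ v) p-prime (subst (p ∣_) (∣u²-v²∣ (ℕP.<⇒≤ u<v)) (ℤ∣.∣⇒∣ᵤ p∣u²-v²)))
      where
      0<v-u : 0 < v ℕ.∸ u
      0<v-u = ℕP.m<n⇒0<n∸m u<v
      v-u<p : v ℕ.∸ u < p
      v-u<p = ℕP.≤-<-trans (ℕP.m∸n≤m v u) (ℕP.≤-<-trans v≤h h<p)
      0<u+v : 0 < u ℕ.+ v
      0<u+v = ℕP.<-≤-trans (ℕP.≤-<-trans z≤n u<v) (ℕP.m≤n+m v u)
      u+v<p : u ℕ.+ v < p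
      u+v<p = s≤s (ℕP.+-mono-≤ (ℕP.<⇒≤ (ℕP.<-≤-trans u<v v≤h)) v≤h)

    %ℕ-≡⇒∣- : ∀ a b → a %ℕ p ≡ b %ℕ p → + p ℤ∣.∣ a - b
    %ℕ-≡⇒∣- a b a%p≡b%p = divides (a /ℕ p - b /ℕ p) (begin
      a - b                                                  ≡⟨ cong₂ _-_ (a≡a%ℕn+[a/ℕn]*n a p) (a≡a%ℕn+[a/ℕn]*n b p) ⟩
      (+ (a %ℕ p) + a /ℕ p * + p) - (+ (b %ℕ p) + b /ℕ p * + p) ≡⟨ cong (λ r → (+ (a %ℕ p) + a /ℕ p * + p) - (+ r + b /ℕ p * + p)) a%p≡b%p ⟨
      (+ (a %ℕ p) + a /ℕ p * + p) - (+ (a %ℕ p) + b /ℕ p * + p) ≡⟨ cancel (+ (a %ℕ p)) (a /ℕ p) (b /ℕ p) (+ p) ⟩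
      (a /ℕ p - b /ℕ p) * + p                                ∎)
      where
      open ≡-Reasoning
      cancel : ∀ r q q′ p → (r + q * p) - (r + q′ * p) ≡ (q - q′) * p
      cancel = ℤ-Ring.solve-∀

    value : (t : ℕ) → Dec (t ≤ h) → ℤ
    value t (yes _) = + t * + t
    value t (no _)  = - (1ℤ + + (t ℕ.∸ suc h) * + (t ℕ.∸ suc h))

    shifted≤h : ∀ {j} → j ≤ p → j ℕ.∸ suc h ≤ h
    shifted≤h {j} j≤p = subst (j ℕ.∸ suc h ≤_) (ℕP.m+n∸m≡n (suc h) h) (ℕP.∸-monoˡ-≤ (suc h) j≤p)

    Solution : Set
    Solution = ∃₂ λ x y → x ≤ h × y ≤ h × p ∣ x ℕ.* x ℕ.+ y ℕ.* y ℕ.+ 1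

    collision⇒solution : ∀ i j (i≤h? : Dec (i ≤ h)) (j≤h? : Dec (j ≤ h)) → i < j → j ≤ p →
                         + p ℤ∣.∣ value i i≤h? - value j j≤h? → Solution
    collision⇒solution i j (yes _) (yes j≤h) i<j _ p∣ = contradiction p∣ (squares-incongruent i<j j≤h)
    collision⇒solution i j (no i≰h) (yes j≤h) i<j _ _ = contradiction (ℕP.≤-trans (ℕP.<⇒≤ i<j) j≤h) i≰h
    collision⇒solution i j (yes i≤h) (no _) _ j≤p p∣ =
      i , y , i≤h , shifted≤h j≤p , subst (p ∣_) (cong ∣_∣ difference) (ℤ∣.∣⇒∣ᵤ p∣)
      where
      y : ℕ
      y = j ℕ.∸ suc h
      ring : ∀ x y → x * x - - (1ℤ + y * y) ≡ x * x + y * y + 1ℤ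
      ring = ℤ-Ring.solve-∀
      difference : + i * + i - - (1ℤ + + y * + y) ≡ + (i ℕ.* i ℕ.+ y ℕ.* y ℕ.+ 1)
      difference = trans (ring (+ i) (+ y)) (sym (trans (ℤP.pos-+ (i ℕ.* i ℕ.+ y ℕ.* y) 1)
        (cong (_+ 1ℤ) (trans (ℤP.pos-+ (i ℕ.* i) (y ℕ.* y)) (cong₂ _+_ (ℤP.pos-* i i) (ℤP.pos-* y y))))))
    collision⇒solution i j (no i≰h) (no _) i<j j≤p p∣ =
      contradiction (subst (+ p ℤ∣.∣_) (ℤP.neg-involutive _) (ℤ∣.∣m⇒∣-m (subst (+ p ℤ∣.∣_) (ring (+ a) (+ b)) p∣)))
                    (squares-incongruent a<b (shifted≤h j≤p))
      where
      a b : ℕ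
      a = i ℕ.∸ suc h
      b = j ℕ.∸ suc h
      a<b : a < b
      a<b = ℕP.∸-monoˡ-< i<j (ℕP.≰⇒> i≰h)
      ring : ∀ a b → - (1ℤ + a * a) - - (1ℤ + b * b) ≡ - (a * a - b * b)
      ring = ℤ-Ring.solve-∀

    residue : Fin (suc p) → Fin p
    residue t = fromℕ< (n%ℕd<d (value (toℕ t) (toℕ t ℕ.≤? h)) p)

    solution : Solution
    solution = from-pigeonhole (pigeonhole (ℕP.n<1+n p) residue)
      where
      from-pigeonhole : ∃₂ (λ i j → toℕ i < toℕ j × residue i ≡ residue j) → Solution
      from-pigeonhole (i , j , i<j , same-residue) =
        collision⇒solution (toℕ i) (toℕ j) (toℕ i ℕ.≤? h) (toℕ j ℕ.≤? h) i<j (ℕP.≤-pred (toℕ<n j))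
          (%ℕ-≡⇒∣- (value (toℕ i) (toℕ i ℕ.≤? h)) (value (toℕ j) (toℕ j ℕ.≤? h))
          (trans (sym (toℕ-fromℕ< _)) (trans (cong toℕ same-residue) (toℕ-fromℕ< _))))

    0<h : 0 < h
    0<h = ℕP.n≢0⇒n>0 λ h≡0 → ¬prime[1] (subst (λ a → Prime (suc (a ℕ.+ a))) h≡0 p-prime)

    x²+y²+1<p² : ∀ {x y} → x ≤ h → y ≤ h → x ℕ.* x ℕ.+ y ℕ.* y ℕ.+ 1 < p ℕ.* p
    x²+y²+1<p² {x} {y} x≤h y≤h = begin-strict
      x ℕ.* x ℕ.+ y ℕ.* y ℕ.+ 1                            ≤⟨ ℕP.+-monoˡ-≤ 1 (ℕP.+-mono-≤ (ℕP.*-mono-≤ x≤h x≤h) (ℕP.*-mono-≤ y≤h y≤h)) ⟩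
      h ℕ.* h ℕ.+ h ℕ.* h ℕ.+ 1                            <⟨ ℕP.m<m+n _ (ℕP.*-mono-≤ (ℕP.≤-trans 0<h (ℕP.m≤m+n h h)) (s≤s z≤n)) ⟩
      (h ℕ.* h ℕ.+ h ℕ.* h ℕ.+ 1) ℕ.+ (h ℕ.+ h) ℕ.* (2 ℕ.+ h) ≡⟨ p² h ⟨
      p ℕ.* p                                              ∎
      where
      open ℕP.≤-Reasoning
      p² : ∀ h → suc (h ℕ.+ h) ℕ.* suc (h ℕ.+ h) ≡ (h ℕ.* h ℕ.+ h ℕ.* h ℕ.+ 1) ℕ.+ (h ℕ.+ h) ℕ.* (2 ℕ.+ h)
      p² = ℕ-Ring.solve-∀

    sumOfFourSquares-odd-prime : SumOfFourSquares p
    sumOfFourSquares-odd-prime = from-solution solution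
      where
      from-solution : Solution → SumOfFourSquares p
      from-solution (x , y , x≤h , y≤h , divides m N≡mp) =
        prime-descent p-prime m {{m≢0}} m<p (v , trans (∥x∥²≡+∑ℕ∣x∣² v) (cong +_ ∑≡mp))
        where
        v : Vector ℤ 4
        v = + x ∷ + y ∷ 1ℤ ∷ 0ℤ ∷ []
        ∑≡mp : x ℕ.* x ℕ.+ (y ℕ.* y ℕ.+ 1) ≡ m ℕ.* p
        ∑≡mp = trans (sym (ℕP.+-assoc (x ℕ.* x) (y ℕ.* y) 1)) N≡mp
        m≢0 : NonZero m
        m≢0 = ℕ.≢-nonZero λ m≡0 →
          contradiction (ℕP.m+n≡0⇒n≡0 (x ℕ.* x ℕ.+ y ℕ.* y) (trans N≡mp (cong (ℕ._* p) m≡0))) λ ()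
        m<p : m < p
        m<p = ℕP.*-cancelʳ-< p m p (subst (_< p ℕ.* p) N≡mp (x²+y²+1<p² x≤h y≤h))

  even-or-odd : ∀ n → (∃[ h ] n ≡ h ℕ.+ h) ⊎ (∃[ h ] n ≡ suc (h ℕ.+ h))
  even-or-odd zero    = inj₁ (0 , refl)
  even-or-odd (suc n) with even-or-odd n
  ... | inj₁ (h , refl) = inj₂ (h , refl)
  ... | inj₂ (h , refl) = inj₁ (suc h , cong suc (sym (ℕP.+-suc h h)))

  sumOfFourSquares-prime : ∀ {p} → Prime p → SumOfFourSquares p
  sumOfFourSquares-prime {p} p-prime with even-or-odd p
  ... | inj₂ (h , refl) = OddPrime.sumOfFourSquares-odd-prime h p-prime
  ... | inj₁ (h , refl) with prime⇒irreducible p-prime (divides h (h+h≡h*2 h))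
    where
    h+h≡h*2 : ∀ h → h ℕ.+ h ≡ h ℕ.* 2
    h+h≡h*2 = ℕ-Ring.solve-∀
  ...   | inj₁ ()
  ...   | inj₂ 2≡p = subst SumOfFourSquares 2≡p (1ℤ ∷ 1ℤ ∷ 0ℤ ∷ 0ℤ ∷ [] , refl)

  sumOfFourSquares-product : ∀ {ps} → All Prime ps → SumOfFourSquares (product ps)
  sumOfFourSquares-product All.[]                 = 1ℤ ∷ 0ℤ ∷ 0ℤ ∷ 0ℤ ∷ [] , refl
  sumOfFourSquares-product (p-prime All.∷ primes) =
    sumOfFourSquares-* (sumOfFourSquares-prime p-prime) (sumOfFourSquares-product primes)

  sumOfFourSquares : ∀ n → SumOfFourSquares n
  sumOfFourSquares zero        = (λ _ → 0ℤ) , refl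
  sumOfFourSquares n@(suc _) = subst SumOfFourSquares (sym isFactorisation) (sumOfFourSquares-product factorsPrime)
    where open PrimeFactorisation (factorise n)

open FourSquares using (SumOfFourSquares; sumOfFourSquares; ∥_∥²)

ι : ℤ → ℚ
ι m = m ℚ./ 1

-- ι m is fromℚᵘ (m/1), so the homomorphism properties of toℚᵘ carry over
ι-+ : ∀ a b → ι (a ℤ.+ b) ≡ ι a ℚ.+ ι b
ι-+ a b = ℚP.toℚᵘ-injective (begin
  toℚᵘ (ι (a ℤ.+ b))                  ≈⟨ ℚP.toℚᵘ-fromℚᵘ (ℚᵘ.mkℚᵘ (a ℤ.+ b) 0) ⟩
  ℚᵘ.mkℚᵘ (a ℤ.+ b) 0                 ≈⟨ ℚᵘ.*≡* (ring a b) ⟩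
  ℚᵘ.mkℚᵘ a 0 ℚᵘ.+ ℚᵘ.mkℚᵘ b 0        ≈⟨ ℚᵘP.+-cong (ℚP.toℚᵘ-fromℚᵘ (ℚᵘ.mkℚᵘ a 0)) (ℚP.toℚᵘ-fromℚᵘ (ℚᵘ.mkℚᵘ b 0)) ⟨
  toℚᵘ (ι a) ℚᵘ.+ toℚᵘ (ι b)          ≈⟨ ℚP.toℚᵘ-homo-+ (ι a) (ι b) ⟨
  toℚᵘ (ι a ℚ.+ ι b)                  ∎)
  where
  open ℚᵘP.≃-Reasoning
  ring : ∀ a b → (a ℤ.+ b) ℤ.* + 1 ≡ (a ℤ.* + 1 ℤ.+ b ℤ.* + 1) ℤ.* + 1
  ring = ℤ-Ring.solve-∀

ι-* : ∀ a b → ι (a ℤ.* b) ≡ ι a ℚ.* ι b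
ι-* a b = ℚP.toℚᵘ-injective (begin
  toℚᵘ (ι (a ℤ.* b))                  ≈⟨ ℚP.toℚᵘ-fromℚᵘ (ℚᵘ.mkℚᵘ (a ℤ.* b) 0) ⟩
  ℚᵘ.mkℚᵘ a 0 ℚᵘ.* ℚᵘ.mkℚᵘ b 0        ≈⟨ ℚᵘP.*-cong (ℚP.toℚᵘ-fromℚᵘ (ℚᵘ.mkℚᵘ a 0)) (ℚP.toℚᵘ-fromℚᵘ (ℚᵘ.mkℚᵘ b 0)) ⟨
  toℚᵘ (ι a) ℚᵘ.* toℚᵘ (ι b)          ≈⟨ ℚP.toℚᵘ-homo-* (ι a) (ι b) ⟨
  toℚᵘ (ι a ℚ.* ι b)                  ∎)
  where open ℚᵘP.≃-Reasoning

ι-∑ : ∀ {n} (v : Vector ℤ n) → ι (∑ℤ v) ≡ ∑ (ι ∘ v)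
ι-∑ {zero}  v = refl
ι-∑ {suc n} v = trans (ι-+ (v zero) (∑ℤ (v ∘ suc))) (cong (ι (v zero) ℚ.+_) (ι-∑ (v ∘ suc)))

IsInteger : ℚ → Set
IsInteger q = ∃[ m ] q ≡ ι m

isInteger-+ : ∀ {p q} → IsInteger p → IsInteger q → IsInteger (p ℚ.+ q)
isInteger-+ (a , refl) (b , refl) = a ℤ.+ b , sym (ι-+ a b)

isInteger-* : ∀ {p q} → IsInteger p → IsInteger q → IsInteger (p ℚ.* q)
isInteger-* (a , refl) (b , refl) = a ℤ.* b , sym (ι-* a b)

isInteger-∑ : ∀ {n} (f : Vector ℚ n) → (∀ i → IsInteger (f i)) → IsInteger (∑ f)
isInteger-∑ {zero}  f _   = 0ℤ , refl
isInteger-∑ {suc n} f int = isInteger-+ (int zero) (isInteger-∑ (f ∘ suc) (int ∘ suc))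

K-≡ : ∀ {z w : K} → re z ≡ re w → im z ≡ im w → z ≡ w
K-≡ = cong₂ _+_√D

sumK≡ : ∀ n (f : Fin n → K) → sumK n f ≡ ∑ (re ∘ f) + ∑ (im ∘ f) √D
sumK≡ zero    f = refl
sumK≡ (suc n) f = cong (f zero +K_) (sumK≡ n (f ∘ suc))

sumK-cong : ∀ n {f g : Fin n → K} → (∀ i → f i ≡ g i) → sumK n f ≡ sumK n g
sumK-cong zero    f≗g = refl
sumK-cong (suc n) f≗g = cong₂ _+K_ (f≗g zero) (sumK-cong n (f≗g ∘ suc))

sumK-+K : ∀ n (f g : Fin n → K) → sumK n f +K sumK n g ≡ sumK n (λ i → f i +K g i)
sumK-+K n f g = begin
  sumK n f +K sumK n g                                      ≡⟨ cong₂ _+K_ (sumK≡ n f) (sumK≡ n g) ⟩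
  (∑ (re ∘ f) ℚ.+ ∑ (re ∘ g)) + (∑ (im ∘ f) ℚ.+ ∑ (im ∘ g)) √D ≡⟨ K-≡ (∑-distrib-+ (re ∘ f) (re ∘ g)) (∑-distrib-+ (im ∘ f) (im ∘ g)) ⟨
  ∑ (re ∘ f+g) + ∑ (im ∘ f+g) √D                              ≡⟨ sumK≡ n f+g ⟨
  sumK n f+g                                                ∎
  where
  open ≡-Reasoning
  f+g : Fin n → K
  f+g i = f i +K g i

sumK-ℚ→K : ∀ n (f : Fin n → ℚ) → sumK n (ℚ→K ∘ f) ≡ ℚ→K (∑ f)
sumK-ℚ→K zero    f = refl
sumK-ℚ→K (suc n) f = cong (ℚ→K (f zero) +K_) (sumK-ℚ→K n (f ∘ suc))

mulK-0K : ∀ D z → mulK D 0K z ≡ 0K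
mulK-0K D z = K-≡ (solve 3 (λ x y d → con 0ℚ :* x :+ d :* con 0ℚ :* y := con 0ℚ) refl (re z) (im z) (ι (+ D)))
                  (solve 2 (λ x y → con 0ℚ :* y :+ con 0ℚ :* x := con 0ℚ) refl (re z) (im z))
  where open +-*-Solver

diag≡0K : ∀ {n} c (i j : Fin n) → toℕ i ≢ toℕ j → diag c i j ≡ 0K
diag≡0K c zero    zero    i≢j = contradiction refl i≢j
diag≡0K c zero    (suc j) i≢j = refl
diag≡0K c (suc i) zero    i≢j = refl
diag≡0K c (suc i) (suc j) i≢j = diag≡0K c i j (i≢j ∘ cong suc)

+K-identityˡ : ∀ z → 0K +K z ≡ z
+K-identityˡ z = K-≡ (ℚP.+-identityˡ (re z)) (ℚP.+-identityˡ (im z))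

+K-identityʳ : ∀ z → z +K 0K ≡ z
+K-identityʳ z = K-≡ (ℚP.+-identityʳ (re z)) (ℚP.+-identityʳ (im z))

sumK-0K : ∀ n → sumK n (λ _ → 0K) ≡ 0K
sumK-0K zero    = refl
sumK-0K (suc n) = cong (0K +K_) (sumK-0K n)

sumK-diag : ∀ D {n} c (P : Fin n → K) i → sumK n (λ j → mulK D (diag c i j) (P j)) ≡ mulK D c (P i)
sumK-diag D {suc n} c P zero = begin
  mulK D c (P zero) +K sumK n (λ j → mulK D 0K (P (suc j)))  ≡⟨ cong (mulK D c (P zero) +K_) (sumK-cong n (mulK-0K D ∘ P ∘ suc)) ⟩
  mulK D c (P zero) +K sumK n (λ _ → 0K)                     ≡⟨ cong (mulK D c (P zero) +K_) (sumK-0K n) ⟩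
  mulK D c (P zero) +K 0K                                    ≡⟨ +K-identityʳ _ ⟩
  mulK D c (P zero)                                          ∎
  where open ≡-Reasoning
sumK-diag D {suc n} c P (suc i) =
  trans (cong (_+K sumK n (λ j → mulK D (diag c i j) (P (suc j)))) (mulK-0K D (P zero)))
        (trans (+K-identityˡ _) (sumK-diag D c (P ∘ suc) i))

-- a copy of the guard that sum≤ applies to each entry
upper : ∀ {n} → Fin n → Fin n → K → K
upper i j x with toℕ i ℕ.≤? toℕ j
... | yes _ = x
... | no  _ = 0K

-- both guards evaluate on the closed indices of Fin 4
sum≤-upper : ∀ (f : Fin 4 → Fin 4 → K) → sum≤ 4 f ≡ sumK 4 (λ i → sumK 4 (λ j → upper i j (f i j)))
sum≤-upper f = refl

upper-diag : ∀ D {n} c (i j : Fin n) x → upper i j (mulK D (diag c i j) x) ≡ mulK D (diag c i j) x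
upper-diag D c i j x with toℕ i ℕ.≤? toℕ j
... | yes _   = refl
... | no  i≰j rewrite diag≡0K c i j (i≰j ∘ ℕP.≤-reflexive) = sym (mulK-0K D x)

sum≤-diag : ∀ D c (P : Fin 4 → Fin 4 → K) →
            sum≤ 4 (λ i j → mulK D (diag c i j) (P i j)) ≡ sumK 4 (λ i → mulK D c (P i i))
sum≤-diag D c P = trans (sum≤-upper (λ i j → mulK D (diag c i j) (P i j))) (sumK-cong 4 λ i →
  trans (sumK-cong 4 (λ j → upper-diag D c i j (P i j))) (sumK-diag D c (P i) i))

g : ℕ → K → ℚ
g D (x + y √D) = x ℚ.* x ℚ.+ ι (+ 3) ℚ.* ι (+ D) ℚ.* (y ℚ.* y)

gK : ℕ → K → K
gK D z = (mulK D 1K (mulK D z z) +K mulK D (-K 1K) (mulK D z (τ z))) +K mulK D 1K (mulK D (τ z) (τ z))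

-- The operations of K are replayed on the syntax of the ring solver, so that the solver sees gK.
gK≡g : ∀ D z → gK D z ≡ ℚ→K (g D z)
gK≡g D z = K-≡
  (solve 3 (λ d x y → proj₁ (gₚ d (x , y)) := x :* x :+ con (ι (+ 3)) :* d :* (y :* y)) refl (ι (+ D)) (re z) (im z))
  (solve 3 (λ d x y → proj₂ (gₚ d (x , y)) := con 0ℚ) refl (ι (+ D)) (re z) (im z))
  where
  open +-*-Solver
  Kₚ : Set
  Kₚ = Polynomial 3 × Polynomial 3
  _+ₚ_ : Kₚ → Kₚ → Kₚ
  (a , b) +ₚ (c , e) = (a :+ c , b :+ e)
  mulₚ : Polynomial 3 → Kₚ → Kₚ → Kₚ
  mulₚ d (a , b) (c , e) = (a :* c :+ d :* b :* e , a :* e :+ b :* c)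
  τₚ -ₚ_ : Kₚ → Kₚ
  τₚ (a , b) = (a , :- b)
  -ₚ (a , b) = (:- a , :- b)
  1ₚ : Kₚ
  1ₚ = (con 1ℚ , con 0ℚ)
  gₚ : Polynomial 3 → Kₚ → Kₚ
  gₚ d z = (mulₚ d 1ₚ (mulₚ d z z) +ₚ mulₚ d (-ₚ 1ₚ) (mulₚ d z (τₚ z))) +ₚ mulₚ d 1ₚ (mulₚ d (τₚ z) (τₚ z))

eval-G₅₁₃ : ∀ D a → eval D G₅₁₃ a ≡ ℚ→K (∑ (g D ∘ a))
eval-G₅₁₃ D a = begin
  eval D G₅₁₃ a
    ≡⟨ cong₂ _+K_ (cong₂ _+K_ (sum≤-diag D 1K (λ i j → mulK D (a i) (a j)))
                              (sumK-cong 4 (λ i → sumK-diag D (-K 1K) (λ j → mulK D (a i) (τ (a j))) i)))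
                  (sum≤-diag D 1K (λ i j → mulK D (τ (a i)) (τ (a j)))) ⟩
  (sumK 4 α₁ +K sumK 4 β₁) +K sumK 4 γ₁
    ≡⟨ cong (_+K sumK 4 γ₁) (sumK-+K 4 α₁ β₁) ⟩
  sumK 4 (λ i → α₁ i +K β₁ i) +K sumK 4 γ₁
    ≡⟨ sumK-+K 4 (λ i → α₁ i +K β₁ i) γ₁ ⟩
  sumK 4 (gK D ∘ a)
    ≡⟨ sumK-cong 4 (gK≡g D ∘ a) ⟩
  sumK 4 (ℚ→K ∘ g D ∘ a)
    ≡⟨ sumK-ℚ→K 4 (g D ∘ a) ⟩
  ℚ→K (∑ (g D ∘ a))
    ∎
  where
  open ≡-Reasoning
  α₁ β₁ γ₁ : Fin 4 → K
  α₁ i = mulK D 1K (mulK D (a i) (a i))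
  β₁ i = mulK D (-K 1K) (mulK D (a i) (τ (a i)))
  γ₁ i = mulK D 1K (mulK D (τ (a i)) (τ (a i)))

-- Positive definiteness

*-nonneg : ∀ {p q} → 0ℚ ℚ.≤ p → 0ℚ ℚ.≤ q → 0ℚ ℚ.≤ p ℚ.* q
*-nonneg {p} {q} 0≤p 0≤q =
  ℚP.nonNegative⁻¹ _ {{ℚP.nonNeg*nonNeg⇒nonNeg p {{ℚ.nonNegative 0≤p}} q {{ℚ.nonNegative 0≤q}}}}

*-pos : ∀ {p q} → 0ℚ ℚ.< p → 0ℚ ℚ.< q → 0ℚ ℚ.< p ℚ.* q
*-pos {p} {q} 0<p 0<q = ℚP.positive⁻¹ _ {{ℚP.pos*pos⇒pos p {{ℚ.positive 0<p}} q {{ℚ.positive 0<q}}}}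

0<x*x : ∀ {x} → x ≢ 0ℚ → 0ℚ ℚ.< x ℚ.* x
0<x*x {x} x≢0 with ℚP.<-cmp x 0ℚ
... | tri< x<0 _ _ = ℚP.positive⁻¹ _ {{ℚP.neg*neg⇒pos x {{ℚ.negative x<0}} x {{ℚ.negative x<0}}}}
... | tri≈ _ x≡0 _ = contradiction x≡0 x≢0
... | tri> _ _ 0<x = *-pos 0<x 0<x

0≤x*x : ∀ x → 0ℚ ℚ.≤ x ℚ.* x
0≤x*x x with x ℚP.≟ 0ℚ
... | yes refl = ℚP.≤-refl
... | no  x≢0  = ℚP.<⇒≤ (0<x*x x≢0)

0<3D : ∀ D .{{_ : ℕ.NonZero D}} → 0ℚ ℚ.< ι (+ 3) ℚ.* ι (+ D)
0<3D D = *-pos {ι (+ 3)} {ι (+ D)} (ℚP.positive⁻¹ _ {{ℚP.normalize-pos 3 1}}) (ℚP.positive⁻¹ _ {{ℚP.normalize-pos D 1}})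

_≟0K : ∀ z → Dec (z ≡ 0K)
z ≟0K = map′ (uncurry K-≡) (λ z≡0 → cong re z≡0 , cong im z≡0) (re z ℚP.≟ 0ℚ ×-dec im z ℚP.≟ 0ℚ)

g-nonneg : ∀ D .{{_ : ℕ.NonZero D}} z → 0ℚ ℚ.≤ g D z
g-nonneg D z = ℚP.+-mono-≤ (0≤x*x (re z)) (*-nonneg (ℚP.<⇒≤ (0<3D D)) (0≤x*x (im z)))

g-pos : ∀ D .{{_ : ℕ.NonZero D}} z → z ≢ 0K → 0ℚ ℚ.< g D z
g-pos D z z≢0 with re z ℚP.≟ 0ℚ
... | no  x≢0 = ℚP.+-mono-<-≤ (0<x*x x≢0) (*-nonneg (ℚP.<⇒≤ (0<3D D)) (0≤x*x (im z)))
... | yes x≡0 = ℚP.+-mono-≤-< (0≤x*x (re z)) (*-pos (0<3D D) (0<x*x (z≢0 ∘ K-≡ x≡0)))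

∑-nonneg : ∀ {n} (f : Vector ℚ n) → (∀ i → 0ℚ ℚ.≤ f i) → 0ℚ ℚ.≤ ∑ f
∑-nonneg {zero}  f _      = ℚP.≤-refl
∑-nonneg {suc n} f 0≤f    = ℚP.+-mono-≤ (0≤f zero) (∑-nonneg (f ∘ suc) (0≤f ∘ suc))

∑-pos : ∀ {n} (f : Vector ℚ n) → (∀ i → 0ℚ ℚ.≤ f i) → ∀ i → 0ℚ ℚ.< f i → 0ℚ ℚ.< ∑ f
∑-pos f 0≤f zero    0<f₀ = ℚP.+-mono-<-≤ 0<f₀ (∑-nonneg (f ∘ suc) (0≤f ∘ suc))
∑-pos f 0≤f (suc i) 0<fᵢ = ℚP.+-mono-≤-< (0≤f zero) (∑-pos (f ∘ suc) (0≤f ∘ suc) i 0<fᵢ)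

positiveDefinite : ∀ D .{{_ : ℕ.NonZero D}} → PositiveDefinite D G₅₁₃
positiveDefinite D a a≢0 = subst (PosK D) (sym (eval-G₅₁₃ D a))
  (inj₁ (refl , ∑-pos (g D ∘ a) (g-nonneg D ∘ a) i (g-pos D (a i) aᵢ≢0)))
  where
  nonzero : ∃[ i ] a i ≢ 0K
  nonzero = ¬∀⟶∃¬ 4 _ (_≟0K ∘ a) a≢0
  i : Fin 4
  i = proj₁ nonzero
  aᵢ≢0 : a i ≢ 0K
  aᵢ≢0 = proj₂ nonzero

-- Integrality and integer values

ℤ→K∈OK : ∀ D m → InOK D (ℤ→K m)
ℤ→K∈OK D m with D % 4
... | 0           = m , 0ℤ , refl
... | 1           = m , 0ℤ , cong (_+ 0ℚ √D) (sym (ℚP.+-identityʳ (ι m)))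
... | suc (suc _) = m , 0ℤ , refl

diag∈OK : ∀ D {n} {c} → InOK D c → ∀ (i j : Fin n) → InOK D (diag c i j)
diag∈OK D c∈OK zero    zero    = c∈OK
diag∈OK D c∈OK zero    (suc j) = ℤ→K∈OK D 0ℤ
diag∈OK D c∈OK (suc i) zero    = ℤ→K∈OK D 0ℤ
diag∈OK D c∈OK (suc i) (suc j) = diag∈OK D c∈OK i j

integral : ∀ D → Integral D G₅₁₃
integral D i j = (λ _ → diag∈OK D (ℤ→K∈OK D 1ℤ) i j) , diag∈OK D (ℤ→K∈OK D -1ℤ) i j , (λ _ → diag∈OK D (ℤ→K∈OK D 1ℤ) i j)

OK-view : ∀ D z → InOK D z →
          (D % 4 ≡ 1 × ∃₂ λ m n → z ≡ (ι m ℚ.+ ι n ℚ.* ½) + (ι n ℚ.* ½) √D)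
          ⊎ (∃₂ λ m n → z ≡ ι m + ι n √D)
OK-view D z with D % 4
... | 0           = inj₂
... | 1           = λ z∈OK → inj₁ (refl , z∈OK)
... | suc (suc _) = inj₂

ι[1+t*4] : ∀ t → ι (+ (1 ℕ.+ t ℕ.* 4)) ≡ 1ℚ ℚ.+ ι (+ t) ℚ.* ι (+ 4)
ι[1+t*4] t = trans (cong ι (ℤP.pos-+ 1 (t ℕ.* 4)))
  (trans (ι-+ (+ 1) (+ (t ℕ.* 4))) (cong (1ℚ ℚ.+_) (trans (cong ι (ℤP.pos-* t 4)) (ι-* (+ t) (+ 4)))))

g-half-integral : ∀ t m n → g (1 ℕ.+ t ℕ.* 4) ((ι m ℚ.+ ι n ℚ.* ½) + (ι n ℚ.* ½) √D) ≡
                  ι m ℚ.* ι m ℚ.+ ι m ℚ.* ι n ℚ.+ (1ℚ ℚ.+ ι (+ 3) ℚ.* ι (+ t)) ℚ.* (ι n ℚ.* ι n)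
g-half-integral t m n = trans (cong (λ d → x ℚ.* x ℚ.+ ι (+ 3) ℚ.* d ℚ.* (y ℚ.* y)) (ι[1+t*4] t))
  (solve 3 (λ m n t → (m :+ n :* con ½) :* (m :+ n :* con ½) :+ con (ι (+ 3)) :* (con 1ℚ :+ t :* con (ι (+ 4))) :* ((n :* con ½) :* (n :* con ½))
                     := m :* m :+ m :* n :+ (con 1ℚ :+ con (ι (+ 3)) :* t) :* (n :* n)) refl (ι m) (ι n) (ι (+ t)))
  where
  open +-*-Solver
  x y : ℚ
  x = ι m ℚ.+ ι n ℚ.* ½
  y = ι n ℚ.* ½

g-isInteger : ∀ D z → InOK D z → IsInteger (g D z)
g-isInteger D z z∈OK with OK-view D z z∈OK
... | inj₂ (m , n , refl) =
  isInteger-+ (isInteger-* (m , refl) (m , refl))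
              (isInteger-* (isInteger-* (+ 3 , refl) (+ D , refl)) (isInteger-* (n , refl) (n , refl)))
... | inj₁ (D%4≡1 , m , n , refl) =
  subst IsInteger (sym (trans (cong (λ d → g d z) D≡1+t*4) (g-half-integral t m n)))
    (isInteger-+ (isInteger-+ (isInteger-* (m , refl) (m , refl)) (isInteger-* (m , refl) (n , refl)))
                 (isInteger-* (isInteger-+ (1ℤ , refl) (isInteger-* (+ 3 , refl) (+ t , refl)))
                              (isInteger-* (n , refl) (n , refl))))
  where
  t : ℕ
  t = D / 4
  D≡1+t*4 : D ≡ 1 ℕ.+ t ℕ.* 4
  D≡1+t*4 = trans (m≡m%n+[m/n]*n D 4) (cong (ℕ._+ t ℕ.* 4) D%4≡1)

ℤ-valued : ∀ D → ℤValued D G₅₁₃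
ℤ-valued D a a∈OK = map₂ (trans (eval-G₅₁₃ D a) ∘ cong ℚ→K)
  (isInteger-∑ (g D ∘ a) (λ i → g-isInteger D (a i) (a∈OK i)))

-- Representing the positive integers

g-ℤ→K : ∀ D v → g D (ℤ→K v) ≡ ι (v ℤ.* v)
g-ℤ→K D v = trans (cong (ι v ℚ.* ι v ℚ.+_) (ℚP.*-zeroʳ (ι (+ 3) ℚ.* ι (+ D))))
                  (trans (ℚP.+-identityʳ (ι v ℚ.* ι v)) (sym (ι-* v v)))

represents : ∀ D → RepresentsAllPositiveIntegers D G₅₁₃
represents D n _ = ℤ→K ∘ w , ℤ→K∈OK D ∘ w , (begin
  eval D G₅₁₃ (ℤ→K ∘ w)         ≡⟨ eval-G₅₁₃ D (ℤ→K ∘ w) ⟩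
  ℚ→K (∑ (g D ∘ ℤ→K ∘ w))        ≡⟨ cong ℚ→K (sum-cong-≗ (g-ℤ→K D ∘ w)) ⟩
  ℚ→K (∑ (λ i → ι (w i ℤ.* w i))) ≡⟨ cong ℚ→K (ι-∑ (λ i → w i ℤ.* w i)) ⟨
  ℚ→K (ι (∥ w ∥²)) ≡⟨ cong (ℚ→K ∘ ι) ∥w∥²≡n ⟩
  ℤ→K (+ n)                       ∎)
  where
  open ≡-Reasoning
  w : Vector ℤ 4
  w = proj₁ (sumOfFourSquares n)
  ∥w∥²≡n : ∥ w ∥² ≡ + n
  ∥w∥²≡n = proj₂ (sumOfFourSquares n)

proposition5p13 : ∀ (D : ℕ) → 2 ≤ D → SquareFree D →
    ℤUniversal D G₅₁₃ × Σ (GQF 4) (λ G → ℤUniversal D G)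
proposition5p13 zero    () _
proposition5p13 D@(suc _) _ _ = universal , G₅₁₃ , universal
  where
  universal : ℤUniversal D G₅₁₃
  universal = positiveDefinite D , integral D , ℤ-valued D , represents D
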